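{- Let $h\geq 5$ be an integer and let $A=[0,h]$. Then \[ h^{\wedge}_{\pm}A = \left[-\frac{h(h+1)}{2}, \frac{h(h+1)}{2}\right], \] and therefore $|h^{\wedge}_{\pm}A| = h^2+h+1$.
   Context: For a finite set $A=\{a_1,\ldots,a_k\}$ of integers and a positive integer $h$, the restricted $h$-fold signed sumset is $h^{\wedge}_{\pm}A=\left\{\sum_{i=1}^{k}\lambda_i a_i : \lambda_i\in\{ -1,0,1\} \text{ for all } i,\ \sum_{i=1}^{k}|\lambda_i| = h\right\}$. For integers $a\le b$, $[a,b]=\{n\in\mathbb{Z}: a\le n\le b\}$. -}

module Defs where

open import Data.Nat as ℕ using (ℕ; zero; suc)
open import Data.Integer as ℤ using (ℤ; +_; -_; _+_; _*_; _≤_)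
open import Data.Vec using (Vec; []; _∷_; tabulate)
open import Data.Fin using (Fin; toℕ)
open import Data.Product using (Σ; ∃; _×_)
open import Relation.Binary.PropositionalEquality using (_≡_)

data Sign : Set where
  neg zero pos : Sign

⟦_⟧ : Sign → ℤ
⟦ neg ⟧ = - (+ 1)
⟦ zero ⟧ = + 0
⟦ pos ⟧ = + 1

∣_∣ˢ : Sign → ℕ
∣ neg ∣ˢ = 1
∣ zero ∣ˢ = 0
∣ pos ∣ˢ = 1

weight : ∀ {k} → Vec Sign k → ℕ
weight [] = 0
weight (l ∷ ls) = ∣ l ∣ˢ ℕ.+ weight ls

signedSum : ∀ {k} → Vec Sign k → Vec ℤ k → ℤ
signedSum [] [] = + 0
signedSum (l ∷ ls) (a ∷ as) = ⟦ l ⟧ * a + signedSum ls as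

-- n ∈ h^∧_± A, where A = {a_1,…,a_k} is given by the list of its
-- (distinct) elements.
_∈RSS[_]_ : ℤ → ℕ → ∀ {k} → Vec ℤ k → Set
n ∈RSS[ h ] A = Σ (Vec Sign _) λ ls → (weight ls ≡ h) × (signedSum ls A ≡ n)

interval0 : (h : ℕ) → Vec ℤ (suc h)
interval0 h = tabulate (λ (i : Fin (suc h)) → + toℕ i)

tri : ℕ → ℕ
tri h = (h ℕ.* suc h) ℕ./ 2

open import Function.Definitions using (Injective)
HasSize : (ℤ → Set) → ℕ → Set
HasSize S N = Σ (Fin N → ℤ) λ f →
  Injective _≡_ _≡_ f × ((i : Fin N) → S (f i)) × ((n : ℤ) → S n → ∃ λ i → f i ≡ n)

module Submission where

open import Level using (0ℓ)
open import Data.Nat as ℕ using (ℕ; _≥_; zero; suc; z≤n; s≤s; ≤′-refl; ≤′-step)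
import Data.Nat.Properties as ℕP
open import Data.Nat.DivMod using (m*n/n≡m)
import Data.Nat.Tactic.RingSolver as ℕSolver
open import Data.Integer as ℤ using (ℤ; +_; -[1+_]; -_; _≤_; _+_; _-_; _*_; +≤+; -≤-)
import Data.Integer.Properties as ℤP
open import Data.Integer.Tactic.RingSolver using (solve-∀)
open import Data.Fin as Fin using (Fin; toℕ; fromℕ; fromℕ<; inject₁)
import Data.Fin.Properties as FinP
open import Data.Vec using (Vec; []; _∷_; _∷ʳ_; tabulate; initLast)
open import Data.Vec.Properties using (tabulate-cong)
open import Data.Product using (_×_; _,_; proj₁; proj₂; ∃)
open import Function.Base using (_∘_)
open import Function.Bundles using (_⇔_; mk⇔)
open import Relation.Binary.PropositionalEquality
open import Relation.Nullary using (yes; no)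
open import Relation.Unary using (Pred; _⊆_; _≐_)
open import Relation.Unary.Properties using (≐-sym)

open import Defs

-- Every signed sum of 0, 1, …, h lies in [-T, T] for T = 0 + 1 + ⋯ + h, whatever its weight.
-- Conversely, if the weight-w sums of a vector cover [-t, t] and s ≤ t, then appending s
-- gives weight-(w+1) sums covering [-t-s, t+s]: a target n ≥ 0 is (n - s) + s, a target
-- n < 0 is (n + s) - s. Since h + 1 ≤ T for h ≥ 2, induction on h from the base case h = 3
-- (for h = 2 the value 0 is missed) shows that the sumset is exactly [-T, T], which has
-- 2T + 1 = h² + h + 1 elements.

triangle : ℕ → ℕ
triangle zero = 0
triangle (suc h) = triangle h ℕ.+ suc h

triangle*2 : ∀ h → triangle h ℕ.* 2 ≡ h ℕ.* suc h
triangle*2 zero = refl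
triangle*2 (suc h) = begin
  (triangle h ℕ.+ suc h) ℕ.* 2      ≡⟨ ℕP.*-distribʳ-+ 2 (triangle h) (suc h) ⟩
  triangle h ℕ.* 2 ℕ.+ suc h ℕ.* 2 ≡⟨ cong (ℕ._+ suc h ℕ.* 2) (triangle*2 h) ⟩
  h ℕ.* suc h ℕ.+ suc h ℕ.* 2      ≡⟨ step h ⟩
  suc h ℕ.* suc (suc h)            ∎
  where
  open ≡-Reasoning
  step : ∀ h → h ℕ.* (1 ℕ.+ h) ℕ.+ (1 ℕ.+ h) ℕ.* 2 ≡ (1 ℕ.+ h) ℕ.* (2 ℕ.+ h)
  step = ℕSolver.solve-∀

tri≡triangle : ∀ h → tri h ≡ triangle h
tri≡triangle h = trans (cong (ℕ._/ 2) (sym (triangle*2 h))) (m*n/n≡m (triangle h) 2)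

n*n+n+1≡suc[triangle+triangle] : ∀ h → h ℕ.* h ℕ.+ h ℕ.+ 1 ≡ suc (triangle h ℕ.+ triangle h)
n*n+n+1≡suc[triangle+triangle] h = begin
  h ℕ.* h ℕ.+ h ℕ.+ 1       ≡⟨ square h ⟩
  suc (h ℕ.* suc h)         ≡⟨ cong suc (triangle*2 h) ⟨
  suc (triangle h ℕ.* 2)     ≡⟨ cong suc (double (triangle h)) ⟩
  suc (triangle h ℕ.+ triangle h) ∎
  where
  open ≡-Reasoning
  square : ∀ h → h ℕ.* h ℕ.+ h ℕ.+ 1 ≡ 1 ℕ.+ h ℕ.* (1 ℕ.+ h)
  square = ℕSolver.solve-∀
  double : ∀ t → t ℕ.* 2 ≡ t ℕ.+ t
  double = ℕSolver.solve-∀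

suc≤triangle : ∀ {h} → 2 ℕ.≤ h → suc h ℕ.≤ triangle h
suc≤triangle {suc (suc k)} (s≤s (s≤s z≤n)) =
  ℕP.+-monoˡ-≤ (suc (suc k)) (ℕP.≤-trans (s≤s z≤n) (ℕP.m≤n+m (suc k) (triangle k)))

SymInterval : ℕ → Pred ℤ 0ℓ
SymInterval t n = - + t ≤ n × n ≤ + t

i+j-j≡i : ∀ i j → i + j - j ≡ i
i+j-j≡i = solve-∀

i-j+j≡i : ∀ i j → i - j + j ≡ i
i-j+j≡i = solve-∀

SymInterval-+ : ∀ {s t m n} → SymInterval s m → SymInterval t n →
                SymInterval (s ℕ.+ t) (m + n)
SymInterval-+ {s} {t} {m} {n} (s≤m , m≤s) (t≤n , n≤t) =
  subst (_≤ m + n) lower (ℤP.+-mono-≤ s≤m t≤n) ,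
  subst (m + n ≤_) (sym (ℤP.pos-+ s t)) (ℤP.+-mono-≤ m≤s n≤t)
  where
  lower : - + s + - + t ≡ - + (s ℕ.+ t)
  lower = trans (sym (ℤP.neg-distrib-+ (+ s) (+ t))) (cong -_ (sym (ℤP.pos-+ s t)))

SymInterval-sign : ∀ l t → SymInterval t (⟦ l ⟧ * + t)
SymInterval-sign neg t rewrite ℤP.-1*i≡-i (+ t) = ℤP.≤-refl , ℤP.neg-≤-pos
SymInterval-sign zero t = ℤP.neg-≤-pos , +≤+ z≤n
SymInterval-sign pos t rewrite ℤP.*-identityˡ (+ t) = ℤP.neg-≤-pos , ℤP.≤-refl

SymInterval-neg : ∀ {t n} → SymInterval t n → SymInterval t (- n)
SymInterval-neg {t} {n} (lower , upper) =
  ℤP.neg-mono-≤ upper , subst (- n ≤_) (ℤP.neg-involutive (+ t)) (ℤP.neg-mono-≤ lower)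

SymInterval-shift : ∀ {s t n} → s ℕ.≤ t → + 0 ≤ n →
                    SymInterval (t ℕ.+ s) n → SymInterval t (n - + s)
SymInterval-shift {s} {t} {n} s≤t 0≤n (_ , upper) =
  ℤP.≤-trans (ℤP.neg-mono-≤ (+≤+ s≤t))
             (subst (_≤ n - + s) (ℤP.+-identityˡ (- + s)) (ℤP.+-monoˡ-≤ (- + s) 0≤n)) ,
  subst (n - + s ≤_) (trans (cong (_- + s) (ℤP.pos-+ t s)) (i+j-j≡i (+ t) (+ s)))
        (ℤP.+-monoˡ-≤ (- + s) upper)

HasSize-SymInterval : ∀ t → HasSize (SymInterval t) (suc (t ℕ.+ t))
HasSize-SymInterval t = f , f-injective , f-∈ , f-onto
  where
  f : Fin (suc (t ℕ.+ t)) → ℤ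
  f i = + toℕ i - + t

  f-injective : ∀ {i j} → f i ≡ f j → i ≡ j
  f-injective {i} {j} fi≡fj = FinP.toℕ-injective (ℤP.+-injective (begin
    + toℕ i     ≡⟨ i-j+j≡i (+ toℕ i) (+ t) ⟨
    f i + + t   ≡⟨ cong (_+ + t) fi≡fj ⟩
    f j + + t   ≡⟨ i-j+j≡i (+ toℕ j) (+ t) ⟩
    + toℕ j     ∎))
    where open ≡-Reasoning

  f-∈ : ∀ i → SymInterval t (f i)
  f-∈ i =
    subst (_≤ f i) (ℤP.+-identityˡ (- + t)) (ℤP.+-monoˡ-≤ (- + t) (+≤+ z≤n)) ,
    subst (f i ≤_) (trans (cong (_- + t) (ℤP.pos-+ t t)) (i+j-j≡i (+ t) (+ t)))
          (ℤP.+-monoˡ-≤ (- + t) (+≤+ (ℕP.≤-pred (FinP.toℕ<n i))))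

  f-onto : ∀ n → SymInterval t n → ∃ λ i → f i ≡ n
  f-onto n (lower , upper) = fromℕ< (s≤s k≤t+t) , (begin
    f (fromℕ< (s≤s k≤t+t)) ≡⟨ cong (λ m → + m - + t) (FinP.toℕ-fromℕ< (s≤s k≤t+t)) ⟩
    + k - + t              ≡⟨ cong (_- + t) k≡n+t ⟩
    n + + t - + t          ≡⟨ i+j-j≡i n (+ t) ⟩
    n                      ∎)
    where
    open ≡-Reasoning
    k = ℤ.∣ n + + t ∣
    k≡n+t : + k ≡ n + + t
    k≡n+t = ℤP.0≤i⇒+∣i∣≡i (subst (_≤ n + + t) (ℤP.+-inverseˡ (+ t)) (ℤP.+-monoˡ-≤ (+ t) lower))
    k≤t+t : k ℕ.≤ t ℕ.+ t
    k≤t+t = ℤP.drop‿+≤+ (subst₂ _≤_ (sym k≡n+t) (sym (ℤP.pos-+ t t)) (ℤP.+-monoˡ-≤ (+ t) upper))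

HasSize-resp-≐ : ∀ {P Q N} → P ≐ Q → HasSize P N → HasSize Q N
HasSize-resp-≐ (P⊆Q , Q⊆P) (f , f-injective , f-∈ , f-onto) =
  f , f-injective , P⊆Q ∘ f-∈ , λ n → f-onto n ∘ Q⊆P

tabulate-∷ʳ : ∀ {a} {A : Set a} {n} (f : Fin (suc n) → A) →
              tabulate f ≡ tabulate (f ∘ inject₁) ∷ʳ f (fromℕ n)
tabulate-∷ʳ {n = zero} f = refl
tabulate-∷ʳ {n = suc n} f = cong (f Fin.zero ∷_) (tabulate-∷ʳ (f ∘ Fin.suc))

interval0-∷ʳ : ∀ h → interval0 (suc h) ≡ interval0 h ∷ʳ + suc h
interval0-∷ʳ h = trans (tabulate-∷ʳ (+_ ∘ toℕ))
  (cong₂ _∷ʳ_ (tabulate-cong (cong +_ ∘ FinP.toℕ-inject₁)) (cong +_ (FinP.toℕ-fromℕ (suc h))))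

weight-∷ʳ : ∀ {k} (ls : Vec Sign k) l → weight (ls ∷ʳ l) ≡ ∣ l ∣ˢ ℕ.+ weight ls
weight-∷ʳ [] l = refl
weight-∷ʳ (x ∷ ls) l =
  trans (cong (∣ x ∣ˢ ℕ.+_) (weight-∷ʳ ls l)) (swap ∣ x ∣ˢ ∣ l ∣ˢ (weight ls))
  where
  swap : ∀ a b c → a ℕ.+ (b ℕ.+ c) ≡ b ℕ.+ (a ℕ.+ c)
  swap = ℕSolver.solve-∀

signedSum-∷ʳ : ∀ {k} (ls : Vec Sign k) as l a →
               signedSum (ls ∷ʳ l) (as ∷ʳ a) ≡ signedSum ls as + ⟦ l ⟧ * a
signedSum-∷ʳ [] [] l a = ℤP.+-comm (⟦ l ⟧ * a) (+ 0)
signedSum-∷ʳ (x ∷ ls) (b ∷ as) l a =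
  trans (cong (λ z → ⟦ x ⟧ * b + z) (signedSum-∷ʳ ls as l a)) (sym (ℤP.+-assoc (⟦ x ⟧ * b) _ _))

∈RSS-∷ʳ : ∀ {k w n a} {as : Vec ℤ k} → n ∈RSS[ w ] as → (l : Sign) →
          (n + ⟦ l ⟧ * a) ∈RSS[ ∣ l ∣ˢ ℕ.+ w ] (as ∷ʳ a)
∈RSS-∷ʳ {as = as} (ls , refl , refl) l = ls ∷ʳ l , weight-∷ʳ ls l , signedSum-∷ʳ ls as l _

signedSum-∷ʳ-bounded : ∀ {k s t} {as : Vec ℤ k} → (∀ ls → SymInterval t (signedSum ls as)) →
                       ∀ ls → SymInterval (t ℕ.+ s) (signedSum ls (as ∷ʳ + s))
signedSum-∷ʳ-bounded {s = s} {as = as} bounded ls with initLast ls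
... | ls′ , l , refl rewrite signedSum-∷ʳ ls′ as l (+ s) =
  SymInterval-+ (bounded ls′) (SymInterval-sign l s)

signedSum-interval0-bounded : ∀ h ls → SymInterval (triangle h) (signedSum ls (interval0 h))
signedSum-interval0-bounded zero (l ∷ []) =
  SymInterval-+ (SymInterval-sign l 0) (ℤP.≤-refl , ℤP.≤-refl)
signedSum-interval0-bounded (suc h) ls rewrite interval0-∷ʳ h =
  signedSum-∷ʳ-bounded (signedSum-interval0-bounded h) ls

covers-∷ʳ : ∀ {k w s t} {as : Vec ℤ k} → s ℕ.≤ t → SymInterval t ⊆ (_∈RSS[ w ] as) →
            SymInterval (t ℕ.+ s) ⊆ (_∈RSS[ suc w ] (as ∷ʳ + s))
covers-∷ʳ {s = s} {t} s≤t covers {n} n∈ with + 0 ℤP.≤? n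
... | yes 0≤n = subst (_∈RSS[ _ ] _) (i-j+1*j≡i n (+ s))
                  (∈RSS-∷ʳ (covers (SymInterval-shift s≤t 0≤n n∈)) pos)
  where
  i-j+1*j≡i : ∀ i j → i - j + (+ 1) * j ≡ i
  i-j+1*j≡i = solve-∀
... | no n≱0 = subst (_∈RSS[ _ ] _) (i+j-1*j≡i n (+ s)) (∈RSS-∷ʳ (covers n+s∈) neg)
  where
  i+j-1*j≡i : ∀ i j → i + j + (- (+ 1)) * j ≡ i
  i+j-1*j≡i = solve-∀
  -[-i-j]≡i+j : ∀ i j → - (- i - j) ≡ i + j
  -[-i-j]≡i+j = solve-∀
  0≤-n : + 0 ≤ - n
  0≤-n = ℤP.neg-mono-≤ (ℤP.<⇒≤ (ℤP.≰⇒> n≱0))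
  n+s∈ : SymInterval t (n + + s)
  n+s∈ = subst (SymInterval t) (-[-i-j]≡i+j n (+ s))
    (SymInterval-neg (SymInterval-shift s≤t 0≤-n (SymInterval-neg n∈)))

interval0-3-covers : SymInterval (triangle 3) ⊆ (_∈RSS[ 3 ] interval0 3)
interval0-3-covers {+ 0} _ = (zero ∷ pos ∷ pos ∷ neg ∷ []) , refl , refl
interval0-3-covers {+ 1} _ = (pos ∷ zero ∷ neg ∷ pos ∷ []) , refl , refl
interval0-3-covers {+ 2} _ = (pos ∷ neg ∷ zero ∷ pos ∷ []) , refl , refl
interval0-3-covers {+ 3} _ = (pos ∷ pos ∷ pos ∷ zero ∷ []) , refl , refl
interval0-3-covers {+ 4} _ = (pos ∷ pos ∷ zero ∷ pos ∷ []) , refl , refl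
interval0-3-covers {+ 5} _ = (pos ∷ zero ∷ pos ∷ pos ∷ []) , refl , refl
interval0-3-covers {+ 6} _ = (zero ∷ pos ∷ pos ∷ pos ∷ []) , refl , refl
interval0-3-covers { -[1+ 0 ]} _ = (pos ∷ zero ∷ pos ∷ neg ∷ []) , refl , refl
interval0-3-covers { -[1+ 1 ]} _ = (pos ∷ pos ∷ zero ∷ neg ∷ []) , refl , refl
interval0-3-covers { -[1+ 2 ]} _ = (pos ∷ neg ∷ neg ∷ zero ∷ []) , refl , refl
interval0-3-covers { -[1+ 3 ]} _ = (pos ∷ neg ∷ zero ∷ neg ∷ []) , refl , refl
interval0-3-covers { -[1+ 4 ]} _ = (pos ∷ zero ∷ neg ∷ neg ∷ []) , refl , refl
interval0-3-covers { -[1+ 5 ]} _ = (zero ∷ neg ∷ neg ∷ neg ∷ []) , refl , refl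
interval0-3-covers {+ suc (suc (suc (suc (suc (suc (suc _))))))}
  (_ , +≤+ (s≤s (s≤s (s≤s (s≤s (s≤s (s≤s ())))))))
interval0-3-covers { -[1+ suc (suc (suc (suc (suc (suc _))))) ]}
  (-≤- (s≤s (s≤s (s≤s (s≤s (s≤s ()))))) , _)

interval0-covers : ∀ {h} → 3 ℕ.≤′ h → SymInterval (triangle h) ⊆ (_∈RSS[ h ] interval0 h)
interval0-covers ≤′-refl = interval0-3-covers
interval0-covers {suc h} (≤′-step 3≤h) rewrite interval0-∷ʳ h =
  covers-∷ʳ (suc≤triangle (ℕP.≤-trans (ℕP.n≤1+n 2) (ℕP.≤′⇒≤ 3≤h))) (interval0-covers 3≤h)

interval0-RSS≐SymInterval : ∀ {h} → 3 ℕ.≤ h →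
                            (_∈RSS[ h ] interval0 h) ≐ SymInterval (triangle h)
interval0-RSS≐SymInterval {h} 3≤h =
  (λ { (ls , _ , refl) → signedSum-interval0-bounded h ls }) ,
  interval0-covers (ℕP.≤⇒≤′ 3≤h)

lemma2p15 : (h : ℕ) → h ≥ 5 →
    ((n : ℤ) → (n ∈RSS[ h ] interval0 h) ⇔ ((- (+ tri h) ≤ n) × (n ≤ + tri h)))
    × HasSize (λ n → n ∈RSS[ h ] interval0 h) (h ℕ.* h ℕ.+ h ℕ.+ 1)
lemma2p15 h h≥5 rewrite tri≡triangle h =
  (λ n → mk⇔ (proj₁ rss≐interval) (proj₂ rss≐interval)) ,
  subst (HasSize _) (sym (n*n+n+1≡suc[triangle+triangle] h))
        (HasSize-resp-≐ (≐-sym rss≐interval) (HasSize-SymInterval (triangle h)))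
  where
  rss≐interval : (_∈RSS[ h ] interval0 h) ≐ SymInterval (triangle h)
  rss≐interval = interval0-RSS≐SymInterval (ℕP.≤-trans (ℕP.m≤n+m 3 2) h≥5)
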